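{- Let $\approx$ be the congruence on ${\cal T}$ generated by a set of types ${\cal F}=\{F_i\mid i\in I\}\subseteq{\cal T}$. If $\Gamma\vdash M:A$ is derivable in ${\cal S}^{\mu}_{\approx}$, then $\Gamma^{\diamond}\vdash M^{\diamond}:A$ is derivable in ${\cal S}^{c}_{\approx}$, where $\Gamma^{\diamond}$ is obtained from $\Gamma$ by replacing each declaration $\alpha:\neg B$ by $x_\alpha:\neg B$.
   Context: Types ${\cal T}$: $A ::= X\mid\bot\mid A\rightarrow A$, $X$ ranging over a set ${\cal A}$ of atomic constants containing a specified subset ${\cal X}=\{X_i\mid i\in I\}$; $\neg A:=A\rightarrow\bot$. The congruence generated by ${\cal F}$ is the least equivalence relation compatible with $\rightarrow$ with $X_i\approx F_i$ for all $i$. $\lambda\mu$-terms: $M ::= x\mid\lambda x.M\mid(M\;M)\mid\mu\alpha.M\mid(\alpha\;M)$ ($x$ term variables, $\alpha$ $\mu$-variables); each $\mu$-variable $\alpha$ comes with a type $\neg A$ (terms à la Church for $\mu$-variables). Contexts: declarations $x:A$, $\alpha:\neg B$, each variable at most once. ${\cal S}^{\mu}_{\approx}$: rules $\Gamma,x:A\vdash x:A$; $\Gamma,x:A\vdash M:B\Rightarrow\Gamma\vdash\lambda x.M:A\rightarrow B$; $\Gamma\vdash M:A\rightarrow B$, $\Gamma\vdash N:A\Rightarrow\Gamma\vdash(M\;N):B$; $\Gamma,\alpha:\neg A\vdash M:A\Rightarrow\Gamma,\alpha:\neg A\vdash(\alpha\;M):\bot$; $\Gamma,\alpha:\neg A\vdash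 M:\bot\Rightarrow\Gamma\vdash\mu\alpha.M:A$; $\Gamma\vdash M:A$, $A\approx B\Rightarrow\Gamma\vdash M:B$. The system ${\cal S}_{\approx}$ on $\lambda$-terms ($x\mid\lambda x.M\mid(M\;M)$) has the first three rules and the $\approx$ rule. Extend $\lambda$-terms with a constant $c_X$ for each $X\in{\cal A}$; $\Gamma\vdash M:A$ in ${\cal S}^{c}_{\approx}$ means $\Gamma, c_{X_1}:\neg\neg X_1\rightarrow X_1,\dots,c_{X_n}:\neg\neg X_n\rightarrow X_n\vdash M:A$ in ${\cal S}_{\approx}$, where $c_{X_1},\dots,c_{X_n}$ are the constants occurring in $M$. Define $\lambda$-terms $T_A$: $T_\bot=\lambda x.(x\;\lambda y.y)$; $T_X=c_X$; $T_{A\rightarrow B}=\lambda x.\lambda y.(T_B\;\lambda u.(x\;\lambda v.(u\;(v\;y))))$. To each $\mu$-variable $\alpha$ of type $\neg A$ associate a $\lambda$-variable $x_\alpha$ of type $\neg A$. Translation: $x^{\diamond}=x$; $(\lambda x.M)^{\diamond}=\lambda x.M^{\diamond}$; $(M\;N)^{\diamond}=(M^{\diamond}\;N^{\diamond})$; $(\mu\alpha.M)^{\diamond}=(T_A\;\lambda x_\alpha.M^{\diamond})$ where $\alpha$ has type $\neg A$; $(\alpha\;M)^{\diamond}=(x_\alpha\;M^{\diamond})$. -}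

module Defs where

open import Data.Nat using (ℕ; zero; suc)
open import Data.List using (List; []; _∷_; map)

infixr 7 _⇒_

data Ty (Atom : Set) : Set where
  atom : Atom → Ty Atom
  bot  : Ty Atom
  _⇒_  : Ty Atom → Ty Atom → Ty Atom

¬ty : {Atom : Set} → Ty Atom → Ty Atom
¬ty A = A ⇒ bot

-- The distinguished subset 𝒳 = {X_i} of atoms is given by X : I → Atom.

module _ {Atom I : Set} (X : I → Atom) (F : I → Ty Atom) where

  data Cong : Ty Atom → Ty Atom → Set where
    ax    : (i : I) → Cong (atom (X i)) (F i)
    refl≈ : {A : Ty Atom} → Cong A A
    sym≈  : {A B : Ty Atom} → Cong A B → Cong B A
    trans≈ : {A B C : Ty Atom} → Cong A B → Cong B C → Cong A C
    ⇒≈    : {A A' B B' : Ty Atom} → Cong A A' → Cong B B' → Cong (A ⇒ B) (A' ⇒ B')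

-- de Bruijn lookup in a context (index 0 = most recent declaration)

data _∋_⦂_ {D : Set} : List D → ℕ → D → Set where
  here  : {d : D} {Γ : List D} → (d ∷ Γ) ∋ zero ⦂ d
  there : {d e : D} {Γ : List D} {n : ℕ} → Γ ∋ n ⦂ e → (d ∷ Γ) ∋ suc n ⦂ e

-- λμ-terms (de Bruijn; a single index space for term and μ-variables).
-- λ-binders are untyped; μ-binders carry the type A of the bound
-- μ-variable α : ¬A (terms à la Church for μ-variables).

data Tmμ (Atom : Set) : Set where
  var   : ℕ → Tmμ Atom
  lam   : Tmμ Atom → Tmμ Atom
  app   : Tmμ Atom → Tmμ Atom → Tmμ Atom
  mu    : Ty Atom → Tmμ Atom → Tmμ Atom
  named : ℕ → Tmμ Atom → Tmμ Atom

data Decl (Atom : Set) : Set where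
  tmv : Ty Atom → Decl Atom
  muv : Ty Atom → Decl Atom      -- α : ¬A

module _ {Atom I : Set} (X : I → Atom) (F : I → Ty Atom) where

  data ⊢μ : List (Decl Atom) → Tmμ Atom → Ty Atom → Set where
    ax-var : {Γ : List (Decl Atom)} {n : ℕ} {A : Ty Atom} →
             Γ ∋ n ⦂ tmv A → ⊢μ Γ (var n) A
    ⇒-intro : {Γ : List (Decl Atom)} {M : Tmμ Atom} {A B : Ty Atom} →
             ⊢μ (tmv A ∷ Γ) M B → ⊢μ Γ (lam M) (A ⇒ B)
    ⇒-elim : {Γ : List (Decl Atom)} {M N : Tmμ Atom} {A B : Ty Atom} →
             ⊢μ Γ M (A ⇒ B) → ⊢μ Γ N A → ⊢μ Γ (app M N) B
    ⊥-intro : {Γ : List (Decl Atom)} {n : ℕ} {M : Tmμ Atom} {A : Ty Atom} →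
             Γ ∋ n ⦂ muv A → ⊢μ Γ M A → ⊢μ Γ (named n M) bot
    μ-intro : {Γ : List (Decl Atom)} {M : Tmμ Atom} {A : Ty Atom} →
             ⊢μ (muv A ∷ Γ) M bot → ⊢μ Γ (mu A M) A
    conv : {Γ : List (Decl Atom)} {M : Tmμ Atom} {A B : Ty Atom} →
             ⊢μ Γ M A → Cong X F A B → ⊢μ Γ M B

data Tmc (Atom : Set) : Set where
  var : ℕ → Tmc Atom
  lam : Tmc Atom → Tmc Atom
  app : Tmc Atom → Tmc Atom → Tmc Atom
  con : Atom → Tmc Atom

-- The system S^c_≈ : S_≈ where each constant c_X is given the type
-- ¬¬X → X (equivalently, declared c_X : ¬¬X → X in the context).
module _ {Atom I : Set} (X : I → Atom) (F : I → Ty Atom) where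

  data ⊢c : List (Ty Atom) → Tmc Atom → Ty Atom → Set where
    ax-var : {Γ : List (Ty Atom)} {n : ℕ} {A : Ty Atom} →
             Γ ∋ n ⦂ A → ⊢c Γ (var n) A
    ax-con : {Γ : List (Ty Atom)} {Y : Atom} →
             ⊢c Γ (con Y) (¬ty (¬ty (atom Y)) ⇒ atom Y)
    ⇒-intro : {Γ : List (Ty Atom)} {M : Tmc Atom} {A B : Ty Atom} →
             ⊢c (A ∷ Γ) M B → ⊢c Γ (lam M) (A ⇒ B)
    ⇒-elim : {Γ : List (Ty Atom)} {M N : Tmc Atom} {A B : Ty Atom} →
             ⊢c Γ M (A ⇒ B) → ⊢c Γ N A → ⊢c Γ (app M N) B
    conv : {Γ : List (Ty Atom)} {M : Tmc Atom} {A B : Ty Atom} →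
             ⊢c Γ M A → Cong X F A B → ⊢c Γ M B

-- The terms T_A (closed terms, so no shifting is needed)
--   T_⊥ = λx.(x λy.y);  T_X = c_X;
--   T_{A→B} = λx.λy.(T_B λu.(x λv.(u (v y))))

T : {Atom : Set} → Ty Atom → Tmc Atom
T bot = lam (app (var 0) (lam (var 0)))
T (atom Y) = con Y
T (A ⇒ B) = lam (lam (app (T B) (lam (app (var 2) (lam (app (var 1) (app (var 0) (var 2))))))))

-- The translation M ↦ M◇ ; the λ-variable x_α occupies the de Bruijn
-- position of α.
_◇ : {Atom : Set} → Tmμ Atom → Tmc Atom
var n ◇ = var n
lam M ◇ = lam (M ◇)
app M N ◇ = app (M ◇) (N ◇)
mu A M ◇ = app (T A) (lam (M ◇))
named n M ◇ = app (var n) (M ◇)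

decl◇ : {Atom : Set} → Decl Atom → Ty Atom
decl◇ (tmv A) = A
decl◇ (muv B) = ¬ty B

ctx◇ : {Atom : Set} → List (Decl Atom) → List (Ty Atom)
ctx◇ = map decl◇

module Submission where

-- T_A is a λ-term proving double-negation elimination ¬¬A → A, built by
-- induction on A from the constants c_X (atoms) and the intuitionistic
-- proofs for ⊥ and for implications.  The translation of μα.M is then
-- T_A applied to λx_α.M◇, i.e. classical reasoning is replaced by the
-- stability of A; every other rule of S^μ_≈ is mapped to itself.

open import Data.List using (List; _∷_; map)
open import Data.Nat using (ℕ)

open import Defs

∋-map : {D E : Set} (f : D → E) {Γ : List D} {n : ℕ} {d : D} →
        Γ ∋ n ⦂ d → map f Γ ∋ n ⦂ f d
∋-map f here      = here
∋-map f (there p) = there (∋-map f p)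

module _ {Atom I : Set} (X : I → Atom) (F : I → Ty Atom) where

  T-dne : (A : Ty Atom) {Γ : List (Ty Atom)} →
          ⊢c X F Γ (T A) (¬ty (¬ty A) ⇒ A)
  T-dne (atom Y) = ax-con
  T-dne bot      = ⇒-intro (⇒-elim (ax-var here) (⇒-intro (ax-var here)))
  T-dne (A ⇒ B)  =
    ⇒-intro (⇒-intro (⇒-elim (T-dne B)
      (⇒-intro (⇒-elim x (⇒-intro (⇒-elim u (⇒-elim v y)))))))
    where
    -- x : ¬¬(A ⇒ B), y : A, u : ¬B, v : A ⇒ B; the de Bruijn index of x is
    -- taken under λu, those of y, u, v under λu.λv
    x = ax-var (there (there here))
    y = ax-var (there (there here))
    u = ax-var (there here)
    v = ax-var here

lemma7p4 : {Atom I : Set} (X : I → Atom) (F : I → Ty Atom)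
    {Γ : List (Decl Atom)} {M : Tmμ Atom} {A : Ty Atom} →
    ⊢μ X F Γ M A → ⊢c X F (ctx◇ Γ) (M ◇) A
lemma7p4 X F (ax-var p)          = ax-var (∋-map decl◇ p)
lemma7p4 X F (⇒-intro d)         = ⇒-intro (lemma7p4 X F d)
lemma7p4 X F (⇒-elim d e)        = ⇒-elim (lemma7p4 X F d) (lemma7p4 X F e)
lemma7p4 X F (⊥-intro p d)       = ⇒-elim (ax-var (∋-map decl◇ p)) (lemma7p4 X F d)
lemma7p4 X F (μ-intro {A = A} d) = ⇒-elim (T-dne X F A) (⇒-intro (lemma7p4 X F d))
lemma7p4 X F (conv d c)          = conv (lemma7p4 X F d) c
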